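{- Let $(h(n))_{n\in\mathbb{N}}$ be defined by $h(n)=1$ for all integers $n\le 1$ and $h(n)=h(n-h(n-1))+h(n-2)$ for $n>1$, and let $r(n)\in\{0,1\}$ be the residue of $h(n)$ modulo $2$. Then the sequence $(r(n))_{n\in\mathbb{N}}$ is $2$-automatic.
   Context: A sequence $(a_n)_{n\in\mathbb{N}}$ is $2$-automatic if its $2$-kernel $\{(a_{2^jn+i})_{n\in\mathbb{N}}: j\in\mathbb{N},\ 0\le i<2^j\}$ is finite (equivalently, $a_n$ is computed by a deterministic finite automaton with output reading the binary expansion of $n$). -}

module Defs where

open import Data.Nat using (ℕ; zero; suc; _+_; _*_; _∸_; _^_; _<_; _%_)
open import Data.List using (List)
open import Data.List.Relation.Unary.Any using (Any)
open import Data.Product using (∃)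
open import Relation.Binary.PropositionalEquality using (_≡_)

-- Fuel-indexed evaluation of the recurrence
--   h(n) = 1 for n ≤ 1,   h(n) = h(n - h(n-1)) + h(n-2) for n > 1.
-- Since h takes value 1 at every integer ≤ 1, evaluating at the truncated
-- index  n ∸ h(n-1)  (which is ≤ 1 exactly when n - h(n-1) ≤ 1) gives the
-- same value as the integer-indexed recurrence.
-- hFuel f m is the true h(m) whenever m < f (all recursive calls are at
-- indices < m because h ≥ 1); the fuel-0 clause is never reached then.
hFuel : ℕ → ℕ → ℕ
hFuel zero    _                 = 1
hFuel (suc f) zero              = 1
hFuel (suc f) (suc zero)        = 1
hFuel (suc f) (suc (suc n))     =
  hFuel f (suc (suc n) ∸ hFuel f (suc n)) + hFuel f n

h : ℕ → ℕ
h n = hFuel (suc n) n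

r : ℕ → ℕ
r n = h n % 2

kernelSeq : (ℕ → ℕ) → ℕ → ℕ → (ℕ → ℕ)
kernelSeq a j i n = a (2 ^ j * n + i)

-- A sequence is 2-automatic iff its 2-kernel is finite: there is a finite
-- list of sequences such that every kernel element equals (pointwise) one
-- of them.
Is2Automatic : (ℕ → ℕ) → Set
Is2Automatic a =
  ∃ λ (L : List (ℕ → ℕ)) →
    ∀ j i → i < 2 ^ j → Any (λ b → ∀ n → kernelSeq a j i n ≡ b n) L

-- Write ρ(n) ∈ ℤ/2 for h(n) mod 2. One shows h(2k+1) = k+1 and h(2k+2) = h(k+1) + h(2k),
-- the latter because h(2k) ≥ 2k turns the recurrence at 2k+3 into h(≤ 1) + h(2k+1).
-- Hence ρ(2k+1) = k+1 mod 2 and ρ(2k) = ρ(0) + ⋯ + ρ(k). With σ, τ, κ the prefix sums of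
-- ρ, σ and ν(k) = k+1 mod 2, the vector V = (ρ, σ, τ, κ, ν, 1) satisfies V(d + 2m) = A_d V(m)
-- for two linear maps A_0, A_1 over ℤ/2, so every element of the 2-kernel of ρ is one of the
-- 2⁶ linear forms evaluated along V.
module Submission where

open import Defs
open import Data.Nat using (ℕ; zero; suc; _+_; _*_; _∸_; _^_; _≤_; _<_; _%_; z≤n; s≤s; parity; ⌊_/2⌋)
open import Data.Nat.Properties
open import Data.Nat.Tactic.RingSolver using (solve-∀)
open import Data.Parity.Base as ℙ using (Parity; 0ℙ; 1ℙ)
open import Data.Parity.Properties as ℙₚ using (+-*-commutativeRing; +-homo-+; *-homo-*; suc-homo-⁻¹)
open import Data.List using (List; []; _∷_; map; cartesianProductWith)
open import Data.List.Membership.Propositional using (_∈_)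
open import Data.List.Membership.Propositional.Properties using (∈-cartesianProductWith⁺)
open import Data.List.Relation.Unary.All as All using (All; all?)
open import Data.List.Relation.Unary.Any as Any using (Any; here; there)
open import Data.List.Relation.Unary.Any.Properties using (map⁺)
open import Data.Vec using (Vec; []; _∷_; foldr; zipWith)
open import Data.Vec.Relation.Binary.Pointwise.Inductive using ([]; _∷_; Pointwise-≡⇒≡)
open import Data.Product using (∃; _×_; _,_; proj₁)
open import Data.Maybe using (Maybe; just; nothing)
open import Relation.Nullary.Decidable using (Dec; from-yes)
open import Relation.Binary.PropositionalEquality
import Tactic.RingSolver as RingSolver
open import Tactic.RingSolver.Core.AlmostCommutativeRing using (AlmostCommutativeRing; fromCommutativeRing)

toℕ : Parity → ℕ
toℕ 0ℙ = 0
toℕ 1ℙ = 1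

n%2≡toℕ[parity[n]] : ∀ n → n % 2 ≡ toℕ (parity n)
n%2≡toℕ[parity[n]] zero          = refl
n%2≡toℕ[parity[n]] (suc zero)    = refl
n%2≡toℕ[parity[n]] (suc (suc n)) = n%2≡toℕ[parity[n]] n

toℕ[parity[n]]+2*⌊n/2⌋≡n : ∀ n → toℕ (parity n) + 2 * ⌊ n /2⌋ ≡ n
toℕ[parity[n]]+2*⌊n/2⌋≡n zero          = refl
toℕ[parity[n]]+2*⌊n/2⌋≡n (suc zero)    = refl
toℕ[parity[n]]+2*⌊n/2⌋≡n (suc (suc n)) =
  trans (shift (toℕ (parity n)) ⌊ n /2⌋) (cong (2 +_) (toℕ[parity[n]]+2*⌊n/2⌋≡n n))
  where
  shift : ∀ b q → b + 2 * suc q ≡ 2 + (b + 2 * q)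
  shift = solve-∀

⌊n/2⌋<m : ∀ {n m} → n < 2 * m → ⌊ n /2⌋ < m
⌊n/2⌋<m {n} {m} n<2m = *-cancelˡ-< 2 ⌊ n /2⌋ m (begin-strict
  2 * ⌊ n /2⌋                   ≤⟨ m≤n+m _ (toℕ (parity n)) ⟩
  toℕ (parity n) + 2 * ⌊ n /2⌋  ≡⟨ toℕ[parity[n]]+2*⌊n/2⌋≡n n ⟩
  n                             <⟨ n<2m ⟩
  2 * m                         ∎)
  where open ≤-Reasoning

module _ {T : Set} (⟦_⟧ : T → ℕ → ℕ) (decimate : Parity → T → T)
         (⟦⟧-decimate : ∀ d t m → ⟦ t ⟧ (toℕ d + 2 * m) ≡ ⟦ decimate d t ⟧ m) where

  kernelSeq-⟦⟧ : ∀ j i → i < 2 ^ j → ∀ t → ∃ λ t′ → ∀ n → kernelSeq ⟦ t ⟧ j i n ≡ ⟦ t′ ⟧ n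
  kernelSeq-⟦⟧ zero    .0 (s≤s z≤n) t = t , λ n → cong ⟦ t ⟧ (trans (+-identityʳ (1 * n)) (*-identityˡ n))
  kernelSeq-⟦⟧ (suc j) i  i<2^[1+j] t
    with kernelSeq-⟦⟧ j ⌊ i /2⌋ (⌊n/2⌋<m i<2^[1+j]) (decimate (parity i) t)
  ... | t′ , ⟦t′⟧ = t′ , λ n → begin
    ⟦ t ⟧ (2 ^ suc j * n + i)                           ≡⟨ cong ⟦ t ⟧ (split n) ⟩
    ⟦ t ⟧ (toℕ (parity i) + 2 * (2 ^ j * n + ⌊ i /2⌋))  ≡⟨ ⟦⟧-decimate (parity i) t _ ⟩
    ⟦ decimate (parity i) t ⟧ (2 ^ j * n + ⌊ i /2⌋)     ≡⟨ ⟦t′⟧ n ⟩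
    ⟦ t′ ⟧ n                                            ∎
    where
    open ≡-Reasoning
    regroup : ∀ b x n q → 2 * x * n + (b + 2 * q) ≡ b + 2 * (x * n + q)
    regroup = solve-∀
    split : ∀ n → 2 ^ suc j * n + i ≡ toℕ (parity i) + 2 * (2 ^ j * n + ⌊ i /2⌋)
    split n = begin
      2 ^ suc j * n + i                               ≡⟨ cong (2 ^ suc j * n +_) (toℕ[parity[n]]+2*⌊n/2⌋≡n i) ⟨
      2 * 2 ^ j * n + (toℕ (parity i) + 2 * ⌊ i /2⌋)  ≡⟨ regroup (toℕ (parity i)) (2 ^ j) n ⌊ i /2⌋ ⟩
      toℕ (parity i) + 2 * (2 ^ j * n + ⌊ i /2⌋)      ∎

  finiteDecimationClosed⇒Is2Automatic : (ts : List T) → (∀ t → t ∈ ts) →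
                                        ∀ {a} t → (∀ n → a n ≡ ⟦ t ⟧ n) → Is2Automatic a
  finiteDecimationClosed⇒Is2Automatic ts complete {a} t a≗⟦t⟧ = map ⟦_⟧ ts , kernel∈ts
    where
    kernel∈ts : ∀ j i → i < 2 ^ j → Any (λ b → ∀ n → kernelSeq a j i n ≡ b n) (map ⟦_⟧ ts)
    kernel∈ts j i i<2^j with kernelSeq-⟦⟧ j i i<2^j t
    ... | t′ , ⟦t′⟧ = map⁺ (Any.map (λ { refl n → trans (a≗⟦t⟧ _) (⟦t′⟧ n) }) (complete t′))

1+m∸n≤m : ∀ m {n} → 1 ≤ n → suc m ∸ n ≤ m
1+m∸n≤m m {suc n} _ = m∸n≤m m n

1+m∸n≤1 : ∀ {m n} → m ≤ n → suc m ∸ n ≤ 1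
1+m∸n≤1 {m} {n} m≤n = subst (suc m ∸ n ≤_) (m+n∸n≡m 1 n) (∸-monoˡ-≤ n (s≤s m≤n))

hFuel-positive : ∀ f m → 1 ≤ hFuel f m
hFuel-positive zero          _             = s≤s z≤n
hFuel-positive (suc f)       zero          = s≤s z≤n
hFuel-positive (suc f)       (suc zero)    = s≤s z≤n
hFuel-positive (suc f)       (suc (suc m)) = ≤-trans (hFuel-positive f _) (m≤m+n _ _)

hFuel-stable : ∀ {f g} m → m < f → m < g → hFuel f m ≡ hFuel g m
hFuel-stable {suc f} {suc g} zero          _ _ = refl
hFuel-stable {suc f} {suc g} (suc zero)    _ _ = refl
hFuel-stable {suc f} {suc g} (suc (suc m)) (s≤s 1+m<f) (s≤s 1+m<g)
  rewrite hFuel-stable (suc m) 1+m<f 1+m<g =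
  cong₂ _+_ (hFuel-stable _ (≤-<-trans index≤1+m 1+m<f) (≤-<-trans index≤1+m 1+m<g))
            (hFuel-stable m (<-trans (n<1+n m) 1+m<f) (<-trans (n<1+n m) 1+m<g))
  where
  index≤1+m : suc (suc m) ∸ hFuel g (suc m) ≤ suc m
  index≤1+m = 1+m∸n≤m (suc m) (hFuel-positive g (suc m))

h-positive : ∀ m → 1 ≤ h m
h-positive m = hFuel-positive (suc m) m

h-rec : ∀ m → h (2 + m) ≡ h (2 + m ∸ h (1 + m)) + h m
h-rec m = cong₂ _+_ (hFuel-stable _ (s≤s (1+m∸n≤m (suc m) (h-positive (suc m)))) ≤-refl)
                    (hFuel-stable m (n≤1+n (suc m)) ≤-refl)

h-≤1 : ∀ {i} → i ≤ 1 → h i ≡ 1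
h-≤1 z≤n       = refl
h-≤1 (s≤s z≤n) = refl

h-≥2 : ∀ m → 2 ≤ h (2 + m)
h-≥2 m rewrite h-rec m = +-mono-≤ (h-positive (2 + m ∸ h (1 + m))) (h-positive m)

h-even-from-odd : ∀ k → h (1 + 2 * k) ≡ suc k → h (2 + 2 * k) ≡ h (1 + k) + h (2 * k)
h-even-from-odd k h[1+2k]≡1+k rewrite h-rec (2 * k) | h[1+2k]≡1+k =
  cong (λ i → h i + h (2 * k)) (trans (cong (_∸ suc k) (double k)) (m+n∸m≡n (suc k) (suc k)))
  where
  double : ∀ x → 2 + 2 * x ≡ suc x + suc x
  double = solve-∀

h-even-bound-step : ∀ k → h (1 + 2 * k) ≡ suc k → 2 * k ≤ h (2 * k) → 2 + 2 * k ≤ h (2 + 2 * k)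
h-even-bound-step k h[1+2k]≡1+k 2k≤h[2k] rewrite h-even-from-odd k h[1+2k]≡1+k with k
... | zero    = ≤-refl
... | suc k′  = +-mono-≤ (h-≥2 k′) 2k≤h[2k]

h-odd-and-even-bound : ∀ k → h (1 + 2 * k) ≡ suc k × 2 * k ≤ h (2 * k)
h-odd-and-even-bound zero = refl , z≤n
h-odd-and-even-bound (suc k) with h-odd-and-even-bound k
... | h[1+2k]≡1+k , 2k≤h[2k] =
  subst (λ x → h (1 + x) ≡ 2 + k × x ≤ h x) (sym (*-suc 2 k)) (h[3+2k]≡2+k , 2+2k≤h[2+2k])
  where
  2+2k≤h[2+2k] : 2 + 2 * k ≤ h (2 + 2 * k)
  2+2k≤h[2+2k] = h-even-bound-step k h[1+2k]≡1+k 2k≤h[2k]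
  h[3+2k]≡2+k : h (3 + 2 * k) ≡ 2 + k
  h[3+2k]≡2+k = trans (h-rec (1 + 2 * k)) (cong₂ _+_ (h-≤1 (1+m∸n≤1 2+2k≤h[2+2k])) h[1+2k]≡1+k)

h-odd : ∀ k → h (1 + 2 * k) ≡ suc k
h-odd k = proj₁ (h-odd-and-even-bound k)

h-even : ∀ k → h (2 + 2 * k) ≡ h (1 + k) + h (2 * k)
h-even k = h-even-from-odd k (h-odd k)

ℤ/2 : AlmostCommutativeRing _ _
ℤ/2 = fromCommutativeRing +-*-commutativeRing 0≟_
  where
  0≟_ : ∀ p → Maybe (0ℙ ≡ p)
  0≟ 0ℙ = just refl
  0≟ 1ℙ = nothing

prefixSum : (ℕ → Parity) → ℕ → Parity
prefixSum f zero    = f zero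
prefixSum f (suc k) = f (suc k) ℙ.+ prefixSum f k

prefixSum-2[1+m] : ∀ f m → prefixSum f (2 * suc m) ≡ f (2 * suc m) ℙ.+ prefixSum f (1 + 2 * m)
prefixSum-2[1+m] f m =
  subst (λ x → prefixSum f x ≡ f x ℙ.+ prefixSum f (1 + 2 * m)) (sym (*-suc 2 m)) refl

ρ σ τ ν κ : ℕ → Parity
ρ m = parity (h m)
σ   = prefixSum ρ
τ   = prefixSum σ
ν m = parity (suc m)
κ   = prefixSum ν

ν-even : ∀ m → ν (2 * m) ≡ 1ℙ
ν-even m = trans (+-homo-+ 1 (2 * m)) (cong ℙ._⁻¹ (*-homo-* 2 m))

ν-odd : ∀ m → ν (1 + 2 * m) ≡ 0ℙ
ν-odd m = *-homo-* 2 m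

ρ-odd : ∀ m → ρ (1 + 2 * m) ≡ ν m
ρ-odd m = cong parity (h-odd m)

ρ-even : ∀ m → ρ (2 * m) ≡ σ m
ρ-even zero    = refl
ρ-even (suc m) = begin
  ρ (2 * suc m)                   ≡⟨ cong ρ (*-suc 2 m) ⟩
  parity (h (2 + 2 * m))          ≡⟨ cong parity (h-even m) ⟩
  parity (h (1 + m) + h (2 * m))  ≡⟨ +-homo-+ (h (1 + m)) (h (2 * m)) ⟩
  ρ (1 + m) ℙ.+ ρ (2 * m)         ≡⟨ cong (ρ (1 + m) ℙ.+_) (ρ-even m) ⟩
  σ (suc m)                       ∎
  where open ≡-Reasoning

κ-even : ∀ m → κ (2 * m) ≡ ν m
κ-odd  : ∀ m → κ (1 + 2 * m) ≡ ν m

κ-even zero    = refl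
κ-even (suc m) = begin
  κ (2 * suc m)                    ≡⟨ prefixSum-2[1+m] ν m ⟩
  ν (2 * suc m) ℙ.+ κ (1 + 2 * m)  ≡⟨ cong₂ ℙ._+_ (ν-even (suc m)) (κ-odd m) ⟩
  ν m ℙ.⁻¹                         ≡⟨ suc-homo-⁻¹ m ⟩
  ν (suc m)                        ∎
  where open ≡-Reasoning

κ-odd m = cong₂ ℙ._+_ (ν-odd m) (κ-even m)

σ-even : ∀ m → σ (2 * m) ≡ τ m ℙ.+ κ m ℙ.+ ν m
σ-odd  : ∀ m → σ (1 + 2 * m) ≡ τ m ℙ.+ κ m

σ-even zero    = refl
σ-even (suc m) = begin
  σ (2 * suc m)                                                 ≡⟨ prefixSum-2[1+m] ρ m ⟩
  ρ (2 * suc m) ℙ.+ σ (1 + 2 * m)                               ≡⟨ cong₂ ℙ._+_ (ρ-even (suc m)) (σ-odd m) ⟩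
  σ (suc m) ℙ.+ (τ m ℙ.+ κ m)                                   ≡⟨ identity (σ (suc m)) (τ m) (κ m) (ν (suc m)) ⟩
  (σ (suc m) ℙ.+ τ m) ℙ.+ (ν (suc m) ℙ.+ κ m) ℙ.+ ν (suc m)     ∎
  where
  open ≡-Reasoning
  identity : ∀ s t k n → s ℙ.+ (t ℙ.+ k) ≡ (s ℙ.+ t) ℙ.+ (n ℙ.+ k) ℙ.+ n
  identity = RingSolver.solve-∀ ℤ/2

σ-odd m = begin
  ρ (1 + 2 * m) ℙ.+ σ (2 * m)            ≡⟨ cong₂ ℙ._+_ (ρ-odd m) (σ-even m) ⟩
  ν m ℙ.+ (τ m ℙ.+ κ m ℙ.+ ν m)          ≡⟨ identity (ν m) (τ m) (κ m) ⟩
  τ m ℙ.+ κ m                            ∎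
  where
  open ≡-Reasoning
  identity : ∀ n t k → n ℙ.+ (t ℙ.+ k ℙ.+ n) ≡ t ℙ.+ k
  identity = RingSolver.solve-∀ ℤ/2

τ-even : ∀ m → τ (2 * m) ≡ τ m
τ-odd  : ∀ m → τ (1 + 2 * m) ≡ κ m

τ-even zero    = refl
τ-even (suc m) = begin
  τ (2 * suc m)                                                          ≡⟨ prefixSum-2[1+m] σ m ⟩
  σ (2 * suc m) ℙ.+ τ (1 + 2 * m)                                        ≡⟨ cong₂ ℙ._+_ (σ-even (suc m)) (τ-odd m) ⟩
  ((σ (suc m) ℙ.+ τ m) ℙ.+ (ν (suc m) ℙ.+ κ m) ℙ.+ ν (suc m)) ℙ.+ κ m    ≡⟨ identity (σ (suc m)) (τ m) (κ m) (ν (suc m)) ⟩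
  τ (suc m)                                                              ∎
  where
  open ≡-Reasoning
  identity : ∀ s t k n → ((s ℙ.+ t) ℙ.+ (n ℙ.+ k) ℙ.+ n) ℙ.+ k ≡ s ℙ.+ t
  identity = RingSolver.solve-∀ ℤ/2

τ-odd m = begin
  σ (1 + 2 * m) ℙ.+ τ (2 * m)    ≡⟨ cong₂ ℙ._+_ (σ-odd m) (τ-even m) ⟩
  τ m ℙ.+ κ m ℙ.+ τ m            ≡⟨ identity (τ m) (κ m) ⟩
  κ m                            ∎
  where
  open ≡-Reasoning
  identity : ∀ t k → t ℙ.+ k ℙ.+ t ≡ k
  identity = RingSolver.solve-∀ ℤ/2

vectors : ∀ n → List (Vec Parity n)
vectors zero    = [] ∷ []
vectors (suc n) = cartesianProductWith _∷_ (0ℙ ∷ 1ℙ ∷ []) (vectors n)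

∈-vectors : ∀ {n} (v : Vec Parity n) → v ∈ vectors n
∈-vectors []       = here refl
∈-vectors (p ∷ v)  = ∈-cartesianProductWith⁺ _∷_ (∈-parities p) (∈-vectors v)
  where
  ∈-parities : ∀ p → p ∈ 0ℙ ∷ 1ℙ ∷ []
  ∈-parities 0ℙ = here refl
  ∈-parities 1ℙ = there (here refl)

_·_ : ∀ {n} → Vec Parity n → Vec Parity n → Parity
a · v = foldr _ ℙ._+_ 0ℙ (zipWith ℙ._*_ a v)

V : ℕ → Vec Parity 6
V m = ρ m ∷ σ m ∷ τ m ∷ κ m ∷ ν m ∷ 1ℙ ∷ []

digitMap : Parity → Vec Parity 6 → Vec Parity 6
digitMap 0ℙ (p ∷ s ∷ t ∷ k ∷ n ∷ o ∷ []) = s ∷ t ℙ.+ k ℙ.+ n ∷ t ∷ n ∷ o ∷ o ∷ []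
digitMap 1ℙ (p ∷ s ∷ t ∷ k ∷ n ∷ o ∷ []) = n ∷ t ℙ.+ k ∷ k ∷ n ∷ 0ℙ ∷ o ∷ []

digitMapᵀ : Parity → Vec Parity 6 → Vec Parity 6
digitMapᵀ 0ℙ (p ∷ s ∷ t ∷ k ∷ n ∷ o ∷ []) = 0ℙ ∷ p ∷ s ℙ.+ t ∷ s ∷ s ℙ.+ k ∷ n ℙ.+ o ∷ []
digitMapᵀ 1ℙ (p ∷ s ∷ t ∷ k ∷ n ∷ o ∷ []) = 0ℙ ∷ 0ℙ ∷ s ∷ s ℙ.+ t ∷ p ℙ.+ k ∷ o ∷ []

V-digit : ∀ d m → V (toℕ d + 2 * m) ≡ digitMap d (V m)
V-digit 0ℙ m = Pointwise-≡⇒≡ (ρ-even m ∷ σ-even m ∷ τ-even m ∷ κ-even m ∷ ν-even m ∷ refl ∷ [])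
V-digit 1ℙ m = Pointwise-≡⇒≡ (ρ-odd m ∷ σ-odd m ∷ τ-odd m ∷ κ-odd m ∷ ν-odd m ∷ refl ∷ [])

·-digitMap : ∀ d a v → a · digitMap d v ≡ digitMapᵀ d a · v
·-digitMap d a v = All.lookup (All.lookup (checked d) (∈-vectors a)) (∈-vectors v)
  where
  Transposed : Parity → Set
  Transposed d = All (λ a → All (λ v → a · digitMap d v ≡ digitMapᵀ d a · v) (vectors 6)) (vectors 6)
  transposed? : ∀ d → Dec (Transposed d)
  transposed? d = all? (λ a → all? (λ v → a · digitMap d v ℙₚ.≟ digitMapᵀ d a · v) (vectors 6)) (vectors 6)
  checked : ∀ d → Transposed d
  checked 0ℙ = from-yes (transposed? 0ℙ)
  checked 1ℙ = from-yes (transposed? 1ℙ)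

⟦_⟧ : Vec Parity 6 → ℕ → ℕ
⟦ a ⟧ m = toℕ (a · V m)

⟦⟧-digitMapᵀ : ∀ d a m → ⟦ a ⟧ (toℕ d + 2 * m) ≡ ⟦ digitMapᵀ d a ⟧ m
⟦⟧-digitMapᵀ d a m = cong toℕ (trans (cong (a ·_) (V-digit d m)) (·-digitMap d a (V m)))

ρ-coordinate : Vec Parity 6
ρ-coordinate = 1ℙ ∷ 0ℙ ∷ 0ℙ ∷ 0ℙ ∷ 0ℙ ∷ 0ℙ ∷ []

r≗⟦ρ-coordinate⟧ : ∀ n → r n ≡ ⟦ ρ-coordinate ⟧ n
r≗⟦ρ-coordinate⟧ n = trans (n%2≡toℕ[parity[n]] (h n)) (cong toℕ (sym (ℙₚ.+-identityʳ (ρ n))))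

theorem3p8 : Is2Automatic r
theorem3p8 = finiteDecimationClosed⇒Is2Automatic ⟦_⟧ digitMapᵀ ⟦⟧-digitMapᵀ (vectors 6) ∈-vectors
  ρ-coordinate r≗⟦ρ-coordinate⟧
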